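{- Let $G$ be an undirected connected loopless multigraph on vertex set $\{0,\dots,n\}$, $n\ge1$. Then $H_{Del_G}(O)$ is a convex polytope with exactly $2^{n+1}-2$ vertices.
   Context: $b_0,\dots,b_n\in\mathbb{R}^{n+1}$ are the rows of the Laplacian $Q(G)=D(G)-A(G)$ (degree matrix minus adjacency matrix with multiplicities). For a permutation $\sigma$ of $\{0,\dots,n\}$ put $u^\sigma_i=\sum_{j=0}^ib_{\sigma(j)}$ ($0\le i\le n$), let $\triangle_\sigma$ be the convex hull of $u^\sigma_0,\dots,u^\sigma_n$, and $H_{Del_G}(O)=\bigcup_\sigma\triangle_\sigma$ over all permutations.
   Formalization: The union $H_{Del_G}(O)$, its convex hulls and the extreme-point test are taken in ℚ^(n+1) instead of $\mathbb{R}^{n+1}$, with rational convex-combination coefficients throughout. -}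

module Defs where

open import Data.Nat as ℕ using (ℕ; zero; suc; _<_)
open import Data.Fin using (Fin; zero; suc; toℕ; inject₁; fromℕ)
open import Data.Integer as ℤ using (ℤ)
open import Data.Rational as ℚ using (ℚ; 0ℚ; 1ℚ)
open import Data.Fin.Permutation using (Permutation′; _⟨$⟩ʳ_)
open import Data.Product using (Σ; ∃; _×_; _,_)
open import Data.Empty using (⊥)
open import Relation.Nullary using (¬_)
open import Relation.Binary.PropositionalEquality using (_≡_)
open import Data.Bool using (if_then_else_)
open import Relation.Nullary.Decidable using (does)
import Data.Fin as F

sumℕ : ∀ {m} → (Fin m → ℕ) → ℕ
sumℕ {zero}  f = 0
sumℕ {suc m} f = f zero ℕ.+ sumℕ (λ k → f (suc k))

sumℤ : ∀ {m} → (Fin m → ℤ) → ℤ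
sumℤ {zero}  f = ℤ.+ 0
sumℤ {suc m} f = f zero ℤ.+ sumℤ (λ k → f (suc k))

sumℚ : ∀ {m} → (Fin m → ℚ) → ℚ
sumℚ {zero}  f = 0ℚ
sumℚ {suc m} f = f zero ℚ.+ sumℚ (λ k → f (suc k))

-- Loopless multigraphs on vertex set {0,…,n} = Fin (suc n),
-- given by a symmetric multiplicity (adjacency) matrix with zero diagonal.

record Multigraph (n : ℕ) : Set where
  field
    A         : Fin (suc n) → Fin (suc n) → ℕ
    symmetric : ∀ i j → A i j ≡ A j i
    loopless  : ∀ i → A i i ≡ 0
open Multigraph public

data Reachable {n} (G : Multigraph n) : Fin (suc n) → Fin (suc n) → Set where
  here : ∀ {i} → Reachable G i i
  step : ∀ {i j k} → 0 < A G i j → Reachable G j k → Reachable G i k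

Connected : ∀ {n} → Multigraph n → Set
Connected {n} G = ∀ (i j : Fin (suc n)) → Reachable G i j

deg : ∀ {n} → Multigraph n → Fin (suc n) → ℕ
deg G i = sumℕ (λ k → A G i k)

laplacian : ∀ {n} → Multigraph n → Fin (suc n) → Fin (suc n) → ℤ
laplacian G i j =
  (if does (i F.≟ j) then ℤ.+ (deg G i) else ℤ.+ 0) ℤ.- ℤ.+ (A G i j)

Point : ℕ → Set
Point n = Fin (suc n) → ℚ

row : ∀ {n} → Multigraph n → Fin (suc n) → Point n
row G i j = laplacian G i j ℚ./ 1

prefixSum : ∀ {n} → Multigraph n → Permutation′ (suc n) → Fin (suc n) → Point n
prefixSum {n} G σ i c =
  sumℚ (λ (j : Fin (suc n)) → if does (toℕ j ℕ.≤? toℕ i) then row G (σ ⟨$⟩ʳ j) c else 0ℚ)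

_≈ᵖ_ : ∀ {n} → Point n → Point n → Set
x ≈ᵖ y = ∀ c → x c ≡ y c

InConvexHull : ∀ {n m} → (Fin m → Point n) → Point n → Set
InConvexHull {n} {m} p x =
  Σ (Fin m → ℚ) λ t →
    (∀ k → 0ℚ ℚ.≤ t k) × (sumℚ t ≡ 1ℚ) ×
    (x ≈ᵖ (λ c → sumℚ (λ k → t k ℚ.* p k c)))

combo : ∀ {n} → ℚ → Point n → Point n → Point n
combo s x y c = s ℚ.* x c ℚ.+ (1ℚ ℚ.- s) ℚ.* y c

IsConvexPolytope : ∀ {n} → (Point n → Set) → Set
IsConvexPolytope {n} P =
  Σ ℕ λ m → Σ (Fin m → Point n) λ p →
    ∀ x → (P x → InConvexHull p x) × (InConvexHull p x → P x)

IsVertex : ∀ {n} → (Point n → Set) → Point n → Set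
IsVertex {n} P x =
  P x ×
  (∀ (y z : Point n) (s : ℚ) → P y → P z → 0ℚ ℚ.< s → s ℚ.< 1ℚ →
     ¬ (y ≈ᵖ z) → ¬ (x ≈ᵖ combo s y z))

HasExactlyVertices : ∀ {n} → (Point n → Set) → ℕ → Set
HasExactlyVertices {n} P N =
  Σ (Fin N → Point n) λ v →
    (∀ k → IsVertex P (v k)) ×
    (∀ k l → v k ≈ᵖ v l → k ≡ l) ×
    (∀ x → IsVertex P x → ∃ λ k → x ≈ᵖ v k)

Hdel : ∀ {n} → Multigraph n → Point n → Set
Hdel G x = ∃ λ (σ : Permutation′ _) → InConvexHull (prefixSum G σ) x

-- Write b_k for the rows of Q(G) and L t = Σ_k t_k b_k. By summation by parts, the point Σ_i λ_i u^σ_i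
-- of △_σ is L t with t_{σ j} = Σ_{i ≥ j} λ_i, a decreasing vector in [0,1]^{n+1}. Conversely, the rows
-- of Q(G) sum to zero, so L t does not change when a constant is added to t, and after sorting every
-- t ∈ [0,1]^{n+1} takes this form. Hence H_{Del_G}(O) is the zonotope L([0,1]^{n+1}), the convex hull of
-- the 2^{n+1} points L(1_S) for S ⊆ {0,…,n}. For connected G the maximum principle shows that L t = L t'
-- only if t − t' is constant. Therefore a point L t with some 0 < t_i < 1 splits along the i-th coordinate
-- and is not a vertex, nor is the origin L(1_∅) = L(1_V), while for ∅ ≠ S ≠ V the point L(1_S) is a
-- vertex that determines S: there are exactly 2^{n+1} − 2 vertices.

module Submission where

open import Defs
open import Data.Nat using (ℕ; suc; _≤_; _^_; _∸_)
open import Data.Product using (_×_)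

open import Data.Bool using (Bool; true; false; if_then_else_)
open import Data.Empty using (⊥-elim)
open import Data.Fin as F using (Fin; toℕ)
open import Data.Fin.Patterns using (0F; 1F)
import Data.Fin.Properties as FP
open import Data.Fin.Permutation as Perm
  using (Permutation′; _⟨$⟩ʳ_; _⟨$⟩ˡ_; inverseˡ; lift₀; transpose; _∘ₚ_)
open import Data.Integer as ℤ using (ℤ)
import Data.Integer.Properties as ℤP
import Data.Nat as ℕ
import Data.Nat.Properties as ℕP
open import Data.Nat.Coprimality as Coprimality using (Coprime)
open import Data.Product using (∃; _,_; proj₁; proj₂; map₂)
open import Data.Rational as ℚ using (ℚ; 0ℚ; 1ℚ; ½; _+_; _*_; _-_; -_)
import Data.Rational.Properties as ℚP
open import Data.Rational.Solver using (module +-*-Solver)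
open import Data.Sum using (inj₁; inj₂)
open import Data.Vec.Functional using (updateAt)
open import Data.Vec.Functional.Properties using (updateAt-updates; updateAt-minimal)
open import Function using (_∘_)
open import Relation.Binary.Definitions using (tri<; tri≈; tri>)
open import Relation.Binary.PropositionalEquality
open import Relation.Nullary using (¬_; yes; no; does)
open import Relation.Nullary.Decidable using (_×-dec_)

import Algebra.Properties.CommutativeMonoid.Sum ℚP.+-0-commutativeMonoid as ℚΣ
open +-*-Solver using (solve; _:+_; _:*_; _:-_; _:=_; con)

private
  variable
    m : ℕ

p≤q⇒0≤q-p : ∀ {p q} → p ℚ.≤ q → 0ℚ ℚ.≤ q - p
p≤q⇒0≤q-p {p} {q} p≤q = subst (ℚ._≤ q - p) (ℚP.+-inverseʳ p) (ℚP.+-monoˡ-≤ (- p) p≤q)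

0≤q-p⇒p≤q : ∀ {p q} → 0ℚ ℚ.≤ q - p → p ℚ.≤ q
0≤q-p⇒p≤q {p} {q} 0≤q-p = subst₂ ℚ._≤_ (ℚP.+-identityʳ p)
  (solve 2 (λ p q → p :+ (q :- p) := q) refl p q) (ℚP.+-monoʳ-≤ p 0≤q-p)

p<q⇒0<q-p : ∀ {p q} → p ℚ.< q → 0ℚ ℚ.< q - p
p<q⇒0<q-p {p} {q} p<q = subst (ℚ._< q - p) (ℚP.+-inverseʳ p) (ℚP.+-monoˡ-< (- p) p<q)

p-q≡0⇒p≡q : ∀ {p q} → p - q ≡ 0ℚ → p ≡ q
p-q≡0⇒p≡q {p} {q} p-q≡0 = begin
  p             ≡⟨ solve 2 (λ p q → p := (p :- q) :+ q) refl p q ⟩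
  (p - q) + q   ≡⟨ cong (_+ q) p-q≡0 ⟩
  0ℚ + q        ≡⟨ ℚP.+-identityˡ q ⟩
  q             ∎
  where open ≡-Reasoning

+-nonNeg : ∀ {p q} → 0ℚ ℚ.≤ p → 0ℚ ℚ.≤ q → 0ℚ ℚ.≤ p + q
+-nonNeg = ℚP.+-mono-≤

*-nonNeg : ∀ {p q} → 0ℚ ℚ.≤ p → 0ℚ ℚ.≤ q → 0ℚ ℚ.≤ p * q
*-nonNeg {p} {q} 0≤p 0≤q = ℚP.nonNegative⁻¹ _
  {{ℚP.nonNeg*nonNeg⇒nonNeg p {{ℚ.nonNegative 0≤p}} q {{ℚ.nonNegative 0≤q}}}}

*-pos : ∀ {p q} → 0ℚ ℚ.< p → 0ℚ ℚ.< q → 0ℚ ℚ.< p * q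
*-pos {p} {q} 0<p 0<q = ℚP.positive⁻¹ _
  {{ℚP.pos*pos⇒pos p {{ℚ.positive 0<p}} q {{ℚ.positive 0<q}}}}

p+q≡0⇒p≡0 : ∀ {p q} → 0ℚ ℚ.≤ p → 0ℚ ℚ.≤ q → p + q ≡ 0ℚ → p ≡ 0ℚ
p+q≡0⇒p≡0 {p} 0≤p 0≤q p+q≡0 =
  ℚP.≤-antisym (subst₂ ℚ._≤_ (ℚP.+-identityʳ p) p+q≡0 (ℚP.+-monoʳ-≤ p 0≤q)) 0≤p

p*q≡0⇒q≡0 : ∀ {p q} → 0ℚ ℚ.< p → p * q ≡ 0ℚ → q ≡ 0ℚ
p*q≡0⇒q≡0 {p} {q} 0<p pq≡0 with ℚP.<-cmp q 0ℚ
... | tri≈ _ q≡0 _ = q≡0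
... | tri> _ _ 0<q = ⊥-elim (ℚP.<-irrefl refl (subst (0ℚ ℚ.<_) pq≡0 (*-pos 0<p 0<q)))
... | tri< q<0 _ _ = ⊥-elim (ℚP.<-irrefl refl (subst (0ℚ ℚ.<_) -pq≡0 (*-pos 0<p (ℚP.neg-antimono-< q<0))))
  where
  -pq≡0 : p * - q ≡ 0ℚ
  -pq≡0 = trans (sym (ℚP.neg-distribʳ-* p q)) (cong -_ pq≡0)

0≤1 : 0ℚ ℚ.≤ 1ℚ
0≤1 = ℚP.nonNegative⁻¹ 1ℚ

0<½ : 0ℚ ℚ.< ½
0<½ = ℚP.positive⁻¹ ½

½<1 : ½ ℚ.< 1ℚ
½<1 = ℚ.*<* (ℤ.+<+ (ℕ.s≤s (ℕ.s≤s ℕ.z≤n)))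

mix : ℚ → ℚ → ℚ → ℚ
mix s a b = s * a + (1ℚ - s) * b

OpenUnitInterval : ℚ → Set
OpenUnitInterval s = 0ℚ ℚ.< s × s ℚ.< 1ℚ

UnitInterval : ℚ → Set
UnitInterval a = 0ℚ ℚ.≤ a × a ℚ.≤ 1ℚ

1-mix : ∀ s a b → 1ℚ - mix s a b ≡ mix s (1ℚ - a) (1ℚ - b)
1-mix = solve 3 (λ s a b → con 1ℚ :- (s :* a :+ (con 1ℚ :- s) :* b)
                         := s :* (con 1ℚ :- a) :+ (con 1ℚ :- s) :* (con 1ℚ :- b)) refl

mix-nonNeg : ∀ {s a b} → OpenUnitInterval s → 0ℚ ℚ.≤ a → 0ℚ ℚ.≤ b → 0ℚ ℚ.≤ mix s a b
mix-nonNeg (0<s , s<1) 0≤a 0≤b =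
  +-nonNeg (*-nonNeg (ℚP.<⇒≤ 0<s) 0≤a) (*-nonNeg (ℚP.<⇒≤ (p<q⇒0<q-p s<1)) 0≤b)

mix-≤1 : ∀ {s a b} → OpenUnitInterval s → a ℚ.≤ 1ℚ → b ℚ.≤ 1ℚ → mix s a b ℚ.≤ 1ℚ
mix-≤1 {s} {a} {b} s∈ a≤1 b≤1 = 0≤q-p⇒p≤q
  (subst (0ℚ ℚ.≤_) (sym (1-mix s a b)) (mix-nonNeg s∈ (p≤q⇒0≤q-p a≤1) (p≤q⇒0≤q-p b≤1)))

mix≡0 : ∀ {s a b} → OpenUnitInterval s → 0ℚ ℚ.≤ a → 0ℚ ℚ.≤ b → mix s a b ≡ 0ℚ → a ≡ 0ℚ × b ≡ 0ℚ
mix≡0 {s} {a} {b} (0<s , s<1) 0≤a 0≤b mix≡zero =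
  p*q≡0⇒q≡0 0<s (p+q≡0⇒p≡0 0≤sa 0≤s'b mix≡zero) ,
  p*q≡0⇒q≡0 (p<q⇒0<q-p s<1) (p+q≡0⇒p≡0 0≤s'b 0≤sa (trans (ℚP.+-comm ((1ℚ - s) * b) (s * a)) mix≡zero))
  where
  0≤sa : 0ℚ ℚ.≤ s * a
  0≤sa = *-nonNeg (ℚP.<⇒≤ 0<s) 0≤a
  0≤s'b : 0ℚ ℚ.≤ (1ℚ - s) * b
  0≤s'b = *-nonNeg (ℚP.<⇒≤ (p<q⇒0<q-p s<1)) 0≤b

mix≡1 : ∀ {s a b} → OpenUnitInterval s → a ℚ.≤ 1ℚ → b ℚ.≤ 1ℚ → mix s a b ≡ 1ℚ → a ≡ 1ℚ × b ≡ 1ℚ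
mix≡1 {s} {a} {b} s∈ a≤1 b≤1 mix≡one =
  sym (p-q≡0⇒p≡q (proj₁ 1-a≡0×1-b≡0)) , sym (p-q≡0⇒p≡q (proj₂ 1-a≡0×1-b≡0))
  where
  1-mix≡0 : mix s (1ℚ - a) (1ℚ - b) ≡ 0ℚ
  1-mix≡0 = trans (sym (1-mix s a b)) (trans (cong (λ x → 1ℚ - x) mix≡one) (ℚP.+-inverseʳ 1ℚ))
  1-a≡0×1-b≡0 : 1ℚ - a ≡ 0ℚ × 1ℚ - b ≡ 0ℚ
  1-a≡0×1-b≡0 = mix≡0 s∈ (p≤q⇒0≤q-p a≤1) (p≤q⇒0≤q-p b≤1) 1-mix≡0

mix-idem : ∀ s a → mix s a a ≡ a
mix-idem = solve 2 (λ s a → s :* a :+ (con 1ℚ :- s) :* a := a) refl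

split-OpenUnitInterval : ∀ {p} → OpenUnitInterval p →
  ∃ λ a → ∃ λ b → UnitInterval a × UnitInterval b × a ≢ b × mix ½ a b ≡ p
split-OpenUnitInterval {p} (0<p , p<1) with p ℚP.≤? ½
... | yes p≤½ = p + p , 0ℚ , (ℚP.<⇒≤ 0<2p , ℚP.+-mono-≤ p≤½ p≤½) , (ℚP.≤-refl , 0≤1) ,
                (λ 2p≡0 → ℚP.<⇒≢ 0<2p (sym 2p≡0)) ,
                solve 1 (λ p → con ½ :* (p :+ p) :+ (con 1ℚ :- con ½) :* con 0ℚ := p) refl p
  where
  0<2p : 0ℚ ℚ.< p + p
  0<2p = ℚP.+-mono-< 0<p 0<p
... | no p≰½ = 1ℚ , p + p - 1ℚ , (0≤1 , ℚP.≤-refl) , (ℚP.<⇒≤ 0<b , 0≤q-p⇒p≤q (ℚP.<⇒≤ 0<1-b)) ,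
               (λ 1≡b → ℚP.<⇒≢ 0<1-b (sym (trans (cong (λ b → 1ℚ - b) (sym 1≡b)) (ℚP.+-inverseʳ 1ℚ)))) ,
               solve 1 (λ p → con ½ :* con 1ℚ :+ (con 1ℚ :- con ½) :* (p :+ p :- con 1ℚ) := p) refl p
  where
  ½<p : ½ ℚ.< p
  ½<p = ℚP.≰⇒> p≰½
  0<b : 0ℚ ℚ.< p + p - 1ℚ
  0<b = p<q⇒0<q-p (ℚP.+-mono-< ½<p ½<p)
  0<1-b : 0ℚ ℚ.< 1ℚ - (p + p - 1ℚ)
  0<1-b = subst (0ℚ ℚ.<_) (solve 1 (λ p → (con 1ℚ :- p) :+ (con 1ℚ :- p) := con 1ℚ :- (p :+ p :- con 1ℚ)) refl p)
    (ℚP.+-mono-< (p<q⇒0<q-p p<1) (p<q⇒0<q-p p<1))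

UnitInterval-boundary : ∀ {p} → UnitInterval p → ¬ OpenUnitInterval p → p ≢ 1ℚ → p ≡ 0ℚ
UnitInterval-boundary {p} (0≤p , p≤1) not-interior p≢1 with ℚP.<-cmp 0ℚ p
... | tri≈ _ 0≡p _ = sym 0≡p
... | tri> _ _ p<0 = ⊥-elim (ℚP.<-irrefl refl (ℚP.<-≤-trans p<0 0≤p))
... | tri< 0<p _ _ with ℚP.<-cmp p 1ℚ
...   | tri< p<1 _ _ = ⊥-elim (not-interior (0<p , p<1))
...   | tri≈ _ p≡1 _ = ⊥-elim (p≢1 p≡1)
...   | tri> _ _ 1<p = ⊥-elim (ℚP.<-irrefl refl (ℚP.<-≤-trans 1<p p≤1))

keepIf : Bool → ℚ → ℚ
keepIf b x = if b then x else 0ℚ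

keepIf-nonNeg : ∀ b {x} → 0ℚ ℚ.≤ x → 0ℚ ℚ.≤ keepIf b x
keepIf-nonNeg true 0≤x = 0≤x
keepIf-nonNeg false _ = ℚP.≤-refl

keepIf-≤ : ∀ b {x} → 0ℚ ℚ.≤ x → keepIf b x ℚ.≤ x
keepIf-≤ true _ = ℚP.≤-refl
keepIf-≤ false 0≤x = 0≤x

*-keepIf : ∀ b x y → x * keepIf b y ≡ keepIf b x * y
*-keepIf true x y = refl
*-keepIf false x y = trans (ℚP.*-zeroʳ x) (sym (ℚP.*-zeroˡ y))

keepIf-* : ∀ b x y → keepIf b (x * y) ≡ keepIf b x * y
keepIf-* true x y = refl
keepIf-* false x y = sym (ℚP.*-zeroˡ y)

sumℚ-cong : {f g : Fin m → ℚ} → (∀ k → f k ≡ g k) → sumℚ f ≡ sumℚ g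
sumℚ-cong {ℕ.zero} f≗g = refl
sumℚ-cong {suc m} f≗g = cong₂ _+_ (f≗g F.zero) (sumℚ-cong (f≗g ∘ F.suc))

sumℚ-zero : sumℚ {m} (λ _ → 0ℚ) ≡ 0ℚ
sumℚ-zero {ℕ.zero} = refl
sumℚ-zero {suc m} = trans (ℚP.+-identityˡ _) (sumℚ-zero {m})

sumℚ-+ : (f g : Fin m → ℚ) → sumℚ (λ k → f k + g k) ≡ sumℚ f + sumℚ g
sumℚ-+ {ℕ.zero} f g = refl
sumℚ-+ {suc m} f g = trans (cong (f F.zero + g F.zero +_) (sumℚ-+ (f ∘ F.suc) (g ∘ F.suc)))
  (solve 4 (λ a b c d → (a :+ b) :+ (c :+ d) := (a :+ c) :+ (b :+ d)) refl
    (f F.zero) (g F.zero) (sumℚ (f ∘ F.suc)) (sumℚ (g ∘ F.suc)))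

sumℚ-neg : (f : Fin m → ℚ) → sumℚ (λ k → - f k) ≡ - sumℚ f
sumℚ-neg {ℕ.zero} f = refl
sumℚ-neg {suc m} f = trans (cong (- f F.zero +_) (sumℚ-neg (f ∘ F.suc)))
  (sym (ℚP.neg-distrib-+ (f F.zero) _))

sumℚ-- : (f g : Fin m → ℚ) → sumℚ (λ k → f k - g k) ≡ sumℚ f - sumℚ g
sumℚ-- f g = trans (sumℚ-+ f (λ k → - g k)) (cong (sumℚ f +_) (sumℚ-neg g))

sumℚ-*ˡ : (c : ℚ) (f : Fin m → ℚ) → sumℚ (λ k → c * f k) ≡ c * sumℚ f
sumℚ-*ˡ {ℕ.zero} c f = sym (ℚP.*-zeroʳ c)
sumℚ-*ˡ {suc m} c f = trans (cong (c * f F.zero +_) (sumℚ-*ˡ c (f ∘ F.suc)))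
  (sym (ℚP.*-distribˡ-+ c _ _))

sumℚ-*ʳ : (c : ℚ) (f : Fin m → ℚ) → sumℚ (λ k → f k * c) ≡ sumℚ f * c
sumℚ-*ʳ c f = trans (sumℚ-cong (λ k → ℚP.*-comm (f k) c)) (trans (sumℚ-*ˡ c f) (ℚP.*-comm c _))

sumℚ-comm : ∀ {m′} (f : Fin m → Fin m′ → ℚ) →
  sumℚ (λ i → sumℚ (λ j → f i j)) ≡ sumℚ (λ j → sumℚ (λ i → f i j))
sumℚ-comm {ℕ.zero} {m′} f = sym (sumℚ-zero {m′})
sumℚ-comm {suc m} f = trans (cong (sumℚ (f F.zero) +_) (sumℚ-comm (f ∘ F.suc)))
  (sym (sumℚ-+ (f F.zero) (λ j → sumℚ (λ i → f (F.suc i) j))))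

sumℚ-nonNeg : {f : Fin m → ℚ} → (∀ k → 0ℚ ℚ.≤ f k) → 0ℚ ℚ.≤ sumℚ f
sumℚ-nonNeg {ℕ.zero} _ = ℚP.≤-refl
sumℚ-nonNeg {suc m} 0≤f = +-nonNeg (0≤f F.zero) (sumℚ-nonNeg (0≤f ∘ F.suc))

sumℚ-mono-≤ : {f g : Fin m → ℚ} → (∀ k → f k ℚ.≤ g k) → sumℚ f ℚ.≤ sumℚ g
sumℚ-mono-≤ {ℕ.zero} _ = ℚP.≤-refl
sumℚ-mono-≤ {suc m} f≤g = ℚP.+-mono-≤ (f≤g F.zero) (sumℚ-mono-≤ (f≤g ∘ F.suc))

sumℚ≡0⇒≡0 : {f : Fin m → ℚ} → (∀ k → 0ℚ ℚ.≤ f k) → sumℚ f ≡ 0ℚ → ∀ k → f k ≡ 0ℚ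
sumℚ≡0⇒≡0 {suc m} {f} 0≤f Σf≡0 F.zero = p+q≡0⇒p≡0 (0≤f F.zero) (sumℚ-nonNeg (0≤f ∘ F.suc)) Σf≡0
sumℚ≡0⇒≡0 {suc m} {f} 0≤f Σf≡0 (F.suc k) = sumℚ≡0⇒≡0 (0≤f ∘ F.suc)
  (p+q≡0⇒p≡0 (sumℚ-nonNeg (0≤f ∘ F.suc)) (0≤f F.zero)
    (trans (ℚP.+-comm (sumℚ (f ∘ F.suc)) (f F.zero)) Σf≡0)) k

sumℚ-select : (c : Fin m) (f : Fin m → ℚ) → sumℚ (λ k → keepIf (does (k F.≟ c)) (f k)) ≡ f c
sumℚ-select {suc m} F.zero f =
  trans (cong (f F.zero +_) (sumℚ-zero {m})) (ℚP.+-identityʳ (f F.zero))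
sumℚ-select {suc m} (F.suc c) f =
  trans (ℚP.+-identityˡ _) (trans (sumℚ-cong select-suc) (sumℚ-select c (f ∘ F.suc)))
  where
  select-suc : ∀ k → keepIf (does (F.suc k F.≟ F.suc c)) (f (F.suc k)) ≡ keepIf (does (k F.≟ c)) (f (F.suc k))
  select-suc k with k F.≟ c
  ... | yes _ = refl
  ... | no _ = refl

sumℚ≡sum : (f : Fin m → ℚ) → sumℚ f ≡ ℚΣ.sum f
sumℚ≡sum {ℕ.zero} f = refl
sumℚ≡sum {suc m} f = cong (f F.zero +_) (sumℚ≡sum (f ∘ F.suc))

sumℚ-permute : (σ : Permutation′ m) (f : Fin m → ℚ) → sumℚ f ≡ sumℚ (λ j → f (σ ⟨$⟩ʳ j))
sumℚ-permute σ f =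
  trans (sumℚ≡sum f) (trans (ℚΣ.sum-permute f σ) (sym (sumℚ≡sum (λ j → f (σ ⟨$⟩ʳ j)))))

argmax : (a : Fin (suc m) → ℚ) → ∃ λ M → ∀ j → a j ℚ.≤ a M
argmax {ℕ.zero} a = F.zero , λ { F.zero → ℚP.≤-refl }
argmax {suc m} a with argmax (a ∘ F.suc)
... | M , a≤aM with ℚP.≤-total (a F.zero) (a (F.suc M))
...   | inj₁ a₀≤ = F.suc M , λ { F.zero → a₀≤ ; (F.suc j) → a≤aM j }
...   | inj₂ ≤a₀ = F.zero , λ { F.zero → ℚP.≤-refl ; (F.suc j) → ℚP.≤-trans (a≤aM j) ≤a₀ }

Descending : (Fin (suc m) → ℚ) → Set
Descending {m} b = ∀ (j : Fin m) → b (F.suc j) ℚ.≤ b (F.inject₁ j)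

sortDescending : (a : Fin (suc m) → ℚ) →
  ∃ λ (σ : Permutation′ (suc m)) → Descending (λ j → a (σ ⟨$⟩ʳ j))
sortDescending {ℕ.zero} a = Perm.id , λ ()
sortDescending {suc m} a with argmax a
... | M , a≤aM with sortDescending (λ j → a (transpose F.zero M ⟨$⟩ʳ F.suc j))
...   | ρ , ρ-desc = lift₀ ρ ∘ₚ transpose F.zero M , desc
  where
  desc : Descending (λ j → a ((lift₀ ρ ∘ₚ transpose F.zero M) ⟨$⟩ʳ j))
  desc F.zero = a≤aM _
  desc (F.suc j) = ρ-desc j

-- Defs.prefixSum tests does (toℕ j ℕ.≤? toℕ i), which computes to j ≤ᵇ i;
-- so prefixSum G σ i c is prefixSumℚ (λ j → row G (σ ⟨$⟩ʳ j) c) i by definition.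
_≤ᵇ_ : Fin m → Fin m → Bool
j ≤ᵇ i = toℕ j ℕ.≤ᵇ toℕ i

suc≤ᵇsuc : ∀ (j i : Fin m) → F.suc j ≤ᵇ F.suc i ≡ j ≤ᵇ i
suc≤ᵇsuc F.zero i = refl
suc≤ᵇsuc (F.suc j) i = refl

prefixSumℚ : (Fin m → ℚ) → Fin m → ℚ
prefixSumℚ β i = sumℚ (λ j → keepIf (j ≤ᵇ i) (β j))

suffixSumℚ : (Fin m → ℚ) → Fin m → ℚ
suffixSumℚ l j = sumℚ (λ i → keepIf (j ≤ᵇ i) (l i))

summation-by-parts : (l β : Fin m → ℚ) →
  sumℚ (λ i → l i * prefixSumℚ β i) ≡ sumℚ (λ j → suffixSumℚ l j * β j)
summation-by-parts l β = begin
  sumℚ (λ i → l i * prefixSumℚ β i)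
    ≡⟨ sumℚ-cong (λ i → sym (sumℚ-*ˡ (l i) (λ j → keepIf (j ≤ᵇ i) (β j)))) ⟩
  sumℚ (λ i → sumℚ (λ j → l i * keepIf (j ≤ᵇ i) (β j)))
    ≡⟨ sumℚ-cong (λ i → sumℚ-cong (λ j → *-keepIf (j ≤ᵇ i) (l i) (β j))) ⟩
  sumℚ (λ i → sumℚ (λ j → keepIf (j ≤ᵇ i) (l i) * β j))
    ≡⟨ sumℚ-comm (λ i j → keepIf (j ≤ᵇ i) (l i) * β j) ⟩
  sumℚ (λ j → sumℚ (λ i → keepIf (j ≤ᵇ i) (l i) * β j))
    ≡⟨ sumℚ-cong (λ j → sumℚ-*ʳ (β j) (λ i → keepIf (j ≤ᵇ i) (l i))) ⟩
  sumℚ (λ j → suffixSumℚ l j * β j) ∎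
  where open ≡-Reasoning

suffixSumℚ-nonNeg : (l : Fin m → ℚ) → (∀ i → 0ℚ ℚ.≤ l i) → ∀ j → 0ℚ ℚ.≤ suffixSumℚ l j
suffixSumℚ-nonNeg l 0≤l j = sumℚ-nonNeg (λ i → keepIf-nonNeg (j ≤ᵇ i) (0≤l i))

suffixSumℚ-≤-sum : (l : Fin m → ℚ) → (∀ i → 0ℚ ℚ.≤ l i) → ∀ j → suffixSumℚ l j ℚ.≤ sumℚ l
suffixSumℚ-≤-sum l 0≤l j = sumℚ-mono-≤ (λ i → keepIf-≤ (j ≤ᵇ i) (0≤l i))

differences : (Fin (suc m) → ℚ) → ℚ → Fin (suc m) → ℚ
differences {ℕ.zero} b K F.zero = b F.zero + K
differences {suc m} b K F.zero = b F.zero - b 1F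
differences {suc m} b K (F.suc i) = differences (b ∘ F.suc) K i

sumℚ-differences : (b : Fin (suc m) → ℚ) (K : ℚ) → sumℚ (differences b K) ≡ b F.zero + K
sumℚ-differences {ℕ.zero} b K = ℚP.+-identityʳ _
sumℚ-differences {suc m} b K =
  trans (cong (b F.zero - b 1F +_) (sumℚ-differences (b ∘ F.suc) K))
    (solve 3 (λ x y k → (x :- y) :+ (y :+ k) := x :+ k) refl (b F.zero) (b 1F) K)

suffixSumℚ-differences : (b : Fin (suc m) → ℚ) (K : ℚ) → ∀ j → suffixSumℚ (differences b K) j ≡ b j + K
suffixSumℚ-differences b K F.zero = sumℚ-differences b K
suffixSumℚ-differences {suc m} b K (F.suc j) = begin
  0ℚ + sumℚ (λ i → keepIf (F.suc j ≤ᵇ F.suc i) (differences (b ∘ F.suc) K i))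
    ≡⟨ ℚP.+-identityˡ _ ⟩
  sumℚ (λ i → keepIf (F.suc j ≤ᵇ F.suc i) (differences (b ∘ F.suc) K i))
    ≡⟨ sumℚ-cong (λ i → cong (λ x → keepIf x (differences (b ∘ F.suc) K i)) (suc≤ᵇsuc j i)) ⟩
  suffixSumℚ (differences (b ∘ F.suc) K) j
    ≡⟨ suffixSumℚ-differences (b ∘ F.suc) K j ⟩
  b (F.suc j) + K ∎
  where open ≡-Reasoning

differences-nonNeg : (b : Fin (suc m) → ℚ) (K : ℚ) → Descending b → (∀ j → 0ℚ ℚ.≤ b j + K) →
  ∀ i → 0ℚ ℚ.≤ differences b K i
differences-nonNeg {ℕ.zero} b K _ 0≤b+K F.zero = 0≤b+K F.zero
differences-nonNeg {suc m} b K desc _ F.zero = p≤q⇒0≤q-p (desc F.zero)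
differences-nonNeg {suc m} b K desc 0≤b+K (F.suc i) =
  differences-nonNeg (b ∘ F.suc) K (desc ∘ F.suc) (0≤b+K ∘ F.suc) i

fromℤ : ℤ → ℚ
fromℤ i = i ℚ./ 1

fromℕ : ℕ → ℚ
fromℕ a = fromℤ (ℤ.+ a)

coprime-1 : ∀ k → Coprime k 1
coprime-1 k = Coprimality.sym (Coprimality.1-coprimeTo k)

fromℤ≡mkℚ : ∀ i → fromℤ i ≡ ℚ.mkℚ i 0 (coprime-1 ℤ.∣ i ∣)
fromℤ≡mkℚ (ℤ.+ k) = ℚP.normalize-coprime (coprime-1 k)
fromℤ≡mkℚ ℤ.-[1+ k ] = cong -_ (ℚP.normalize-coprime (coprime-1 (suc k)))

fromℤ-+ : ∀ a b → fromℤ (a ℤ.+ b) ≡ fromℤ a + fromℤ b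
fromℤ-+ a b = begin
  fromℤ (a ℤ.+ b)
    ≡⟨ cong fromℤ (sym (cong₂ ℤ._+_ (ℤP.*-identityʳ a) (ℤP.*-identityʳ b))) ⟩
  fromℤ (a ℤ.* ℤ.+ 1 ℤ.+ b ℤ.* ℤ.+ 1)
    ≡⟨⟩
  ℚ.mkℚ a 0 (coprime-1 ℤ.∣ a ∣) + ℚ.mkℚ b 0 (coprime-1 ℤ.∣ b ∣)
    ≡⟨ sym (cong₂ _+_ (fromℤ≡mkℚ a) (fromℤ≡mkℚ b)) ⟩
  fromℤ a + fromℤ b ∎
  where open ≡-Reasoning

fromℤ-neg : ∀ a → fromℤ (ℤ.- a) ≡ - fromℤ a
fromℤ-neg (ℤ.+ ℕ.zero) = refl
fromℤ-neg (ℤ.+ suc k) = trans (fromℤ≡mkℚ _) (cong -_ (sym (fromℤ≡mkℚ (ℤ.+ suc k))))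
fromℤ-neg ℤ.-[1+ k ] = trans (fromℤ≡mkℚ _) (cong -_ (sym (fromℤ≡mkℚ ℤ.-[1+ k ])))

fromℤ-- : ∀ a b → fromℤ (a ℤ.- b) ≡ fromℤ a - fromℤ b
fromℤ-- a b = trans (fromℤ-+ a (ℤ.- b)) (cong (fromℤ a +_) (fromℤ-neg b))

fromℕ-sumℕ : (f : Fin m → ℕ) → fromℕ (sumℕ f) ≡ sumℚ (λ k → fromℕ (f k))
fromℕ-sumℕ {ℕ.zero} f = refl
fromℕ-sumℕ {suc m} f =
  trans (fromℤ-+ (ℤ.+ f F.zero) (ℤ.+ sumℕ (f ∘ F.suc))) (cong (fromℕ (f F.zero) +_) (fromℕ-sumℕ (f ∘ F.suc)))

fromℕ-nonNeg : ∀ a → 0ℚ ℚ.≤ fromℕ a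
fromℕ-nonNeg a = subst (0ℚ ℚ.≤_) (sym (fromℤ≡mkℚ (ℤ.+ a))) (ℚP.nonNegative⁻¹ _)

fromℕ-pos : ∀ a → 0 ℕ.< a → 0ℚ ℚ.< fromℕ a
fromℕ-pos (suc a) _ = subst (0ℚ ℚ.<_) (sym (fromℤ≡mkℚ (ℤ.+ suc a))) (ℚP.positive⁻¹ _)

-- Merge the weights of all points p i sent to the same q k.
InConvexHull-reindex : ∀ {n m m′} {p : Fin m → Point n} {q : Fin m′ → Point n} (f : Fin m → Fin m′) →
  (∀ i → p i ≈ᵖ q (f i)) → ∀ {x} → InConvexHull p x → InConvexHull q x
InConvexHull-reindex {m = m} {m′} {p} {q} f p≈qf {x} (l , 0≤l , Σl≡1 , x≈) = μ , 0≤μ , Σμ≡1 , x≈′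
  where
  μ : Fin m′ → ℚ
  μ k = sumℚ (λ i → keepIf (does (k F.≟ f i)) (l i))
  0≤μ : ∀ k → 0ℚ ℚ.≤ μ k
  0≤μ k = sumℚ-nonNeg (λ i → keepIf-nonNeg (does (k F.≟ f i)) (0≤l i))
  Σμ≡1 : sumℚ μ ≡ 1ℚ
  Σμ≡1 = trans (sumℚ-comm (λ k i → keepIf (does (k F.≟ f i)) (l i)))
    (trans (sumℚ-cong (λ i → sumℚ-select (f i) (λ _ → l i))) Σl≡1)
  x≈′ : x ≈ᵖ (λ c → sumℚ (λ k → μ k * q k c))
  x≈′ c = begin
    x c
      ≡⟨ x≈ c ⟩
    sumℚ (λ i → l i * p i c)
      ≡⟨ sumℚ-cong (λ i → cong (l i *_) (p≈qf i c)) ⟩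
    sumℚ (λ i → l i * q (f i) c)
      ≡⟨ sumℚ-cong (λ i → sym (sumℚ-select (f i) (λ k → l i * q k c))) ⟩
    sumℚ (λ i → sumℚ (λ k → keepIf (does (k F.≟ f i)) (l i * q k c)))
      ≡⟨ sumℚ-cong (λ i → sumℚ-cong (λ k → keepIf-* (does (k F.≟ f i)) (l i) (q k c))) ⟩
    sumℚ (λ i → sumℚ (λ k → keepIf (does (k F.≟ f i)) (l i) * q k c))
      ≡⟨ sumℚ-comm (λ i k → keepIf (does (k F.≟ f i)) (l i) * q k c) ⟩
    sumℚ (λ k → sumℚ (λ i → keepIf (does (k F.≟ f i)) (l i) * q k c))
      ≡⟨ sumℚ-cong (λ k → sumℚ-*ʳ (q k c) (λ i → keepIf (does (k F.≟ f i)) (l i))) ⟩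
    sumℚ (λ k → μ k * q k c) ∎
    where open ≡-Reasoning

IsVertex-cong : ∀ {n} {P Q : Point n → Set} → (∀ x → P x → Q x) → (∀ x → Q x → P x) →
  ∀ {x} → IsVertex P x → IsVertex Q x
IsVertex-cong P⊆Q Q⊆P {x} (Px , extreme) =
  P⊆Q x Px , λ y z s Qy Qz → extreme y z s (Q⊆P y Qy) (Q⊆P z Qz)

UnitCube : (Fin m → ℚ) → Set
UnitCube t = ∀ k → UnitInterval (t k)

mix-UnitCube : ∀ {s} {u v : Fin m → ℚ} → OpenUnitInterval s → UnitCube u → UnitCube v →
  UnitCube (λ k → mix s (u k) (v k))
mix-UnitCube s∈ u∈ v∈ k =
  mix-nonNeg s∈ (proj₁ (u∈ k)) (proj₁ (v∈ k)) , mix-≤1 s∈ (proj₂ (u∈ k)) (proj₂ (v∈ k))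

bitℚ : Fin 2 → ℚ
bitℚ 0F = 0ℚ
bitℚ (1F) = 1ℚ

χ : (Fin m → Fin 2) → Fin m → ℚ
χ S k = bitℚ (S k)

χ-UnitCube : (S : Fin m → Fin 2) → UnitCube (χ S)
χ-UnitCube S k with S k
... | 0F = ℚP.≤-refl , 0≤1
... | 1F = 0≤1 , ℚP.≤-refl

bitℚ-injective : ∀ {a b} → bitℚ a ≡ bitℚ b → a ≡ b
bitℚ-injective {0F} {0F} _ = refl
bitℚ-injective {0F} {1F} ()
bitℚ-injective {1F} {0F} ()
bitℚ-injective {1F} {1F} _ = refl

mix≡bitℚ⇒≡ : ∀ {s a b} → OpenUnitInterval s → UnitInterval a → UnitInterval b → ∀ e → mix s a b ≡ bitℚ e → a ≡ b
mix≡bitℚ⇒≡ {a = a} {b} s∈ (0≤a , _) (0≤b , _) 0F mix≡zero =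
  trans (proj₁ a≡0×b≡0) (sym (proj₂ a≡0×b≡0))
  where
  a≡0×b≡0 : a ≡ 0ℚ × b ≡ 0ℚ
  a≡0×b≡0 = mix≡0 s∈ 0≤a 0≤b mix≡zero
mix≡bitℚ⇒≡ {a = a} {b} s∈ (_ , a≤1) (_ , b≤1) 1F mix≡one =
  trans (proj₁ a≡1×b≡1) (sym (proj₂ a≡1×b≡1))
  where
  a≡1×b≡1 : a ≡ 1ℚ × b ≡ 1ℚ
  a≡1×b≡1 = mix≡1 s∈ a≤1 b≤1 mix≡one

NonConstant : (Fin m → Fin 2) → Set
NonConstant S = (∃ λ i → S i ≡ 1F) × (∃ λ j → S j ≡ 0F)

≢0⇒≡1 : ∀ {b : Fin 2} → b ≢ 0F → b ≡ 1F
≢0⇒≡1 {0F} b≢0 = ⊥-elim (b≢0 refl)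
≢0⇒≡1 {1F} _ = refl

≢1⇒≡0 : ∀ {b : Fin 2} → b ≢ 1F → b ≡ 0F
≢1⇒≡0 {0F} _ = refl
≢1⇒≡0 {1F} b≢1 = ⊥-elim (b≢1 refl)

nonConstant : (S : Fin m → Fin 2) → ¬ (∀ i → S i ≡ 0F) → ¬ (∀ i → S i ≡ 1F) → NonConstant S
nonConstant {m} S not-all-0 not-all-1 with FP.¬∀⟶∃¬ m _ (λ i → S i F.≟ 0F) not-all-0
                                         | FP.¬∀⟶∃¬ m _ (λ i → S i F.≟ 1F) not-all-1
... | i , Si≢0 | j , Sj≢1 = (i , ≢0⇒≡1 Si≢0) , (j , ≢1⇒≡0 Sj≢1)

another : ∀ {n} → 1 ≤ n → (i : Fin (suc n)) → ∃ λ j → j ≢ i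
another (ℕ.s≤s ℕ.z≤n) F.zero = 1F , λ ()
another (ℕ.s≤s ℕ.z≤n) (F.suc i) = F.zero , λ ()

-- Indexing the subsets of Fin m by Fin (2 ^ m)

IsInner : ∀ {p} → Fin p → Set
IsInner {p} i = toℕ i ≢ 0 × suc (toℕ i) ≢ p

innerIndex : ∀ {p} → 2 ≤ p → Fin (p ∸ 2) → Fin p
innerIndex (ℕ.s≤s (ℕ.s≤s ℕ.z≤n)) k = F.suc (F.inject₁ k)

innerIndex-isInner : ∀ {p} (2≤p : 2 ≤ p) k → IsInner (innerIndex 2≤p k)
innerIndex-isInner (ℕ.s≤s (ℕ.s≤s ℕ.z≤n)) k =
  (λ ()) , λ last → FP.toℕ-inject₁-≢ k (sym (ℕP.suc-injective (ℕP.suc-injective last)))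

innerIndex-injective : ∀ {p} (2≤p : 2 ≤ p) {k l} → innerIndex 2≤p k ≡ innerIndex 2≤p l → k ≡ l
innerIndex-injective (ℕ.s≤s (ℕ.s≤s ℕ.z≤n)) eq = FP.inject₁-injective (FP.suc-injective eq)

innerIndex-surjective : ∀ {p} (2≤p : 2 ≤ p) (i : Fin p) → IsInner i → ∃ λ k → innerIndex 2≤p k ≡ i
innerIndex-surjective (ℕ.s≤s (ℕ.s≤s ℕ.z≤n)) F.zero (not-first , _) = ⊥-elim (not-first refl)
innerIndex-surjective {suc (suc q)} (ℕ.s≤s (ℕ.s≤s ℕ.z≤n)) (F.suc j) (_ , not-last) =
  F.lower₁ j q≢j , cong F.suc (FP.inject₁-lower₁ j q≢j)
  where
  q≢j : q ≢ toℕ j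
  q≢j q≡j = not-last (cong (suc ∘ suc) (sym q≡j))

funToFin-cong : ∀ {k} {f g : Fin m → Fin k} → (∀ i → f i ≡ g i) → F.funToFin f ≡ F.funToFin g
funToFin-cong {ℕ.zero} _ = refl
funToFin-cong {suc m} f≗g = cong₂ F.combine (f≗g F.zero) (funToFin-cong (f≗g ∘ F.suc))

finToFun-injective : ∀ {k} {a b : Fin (k ^ m)} →
  (∀ i → F.finToFun {k} {m} a i ≡ F.finToFun b i) → a ≡ b
finToFun-injective {m} {k} {a} {b} a≗b = begin
  a                                     ≡⟨ sym (FP.funToFin-finToFin {m} {k} a) ⟩
  F.funToFin (F.finToFun {k} {m} a)     ≡⟨ funToFin-cong a≗b ⟩
  F.funToFin (F.finToFun {k} {m} b)     ≡⟨ FP.funToFin-finToFin {m} {k} b ⟩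
  b                                     ∎
  where open ≡-Reasoning

subsetIndex : (Fin m → Fin 2) → Fin (2 ^ m)
subsetIndex = F.funToFin

subsetAt : Fin (2 ^ m) → Fin m → Fin 2
subsetAt = F.finToFun

subsetAt-subsetIndex : (S : Fin m → Fin 2) → ∀ i → subsetAt (subsetIndex S) i ≡ S i
subsetAt-subsetIndex = FP.finToFun-funToFin

subsetIndex-injective : {S T : Fin m → Fin 2} → subsetIndex S ≡ subsetIndex T → ∀ i → S i ≡ T i
subsetIndex-injective {S = S} {T} eq i = begin
  S i                           ≡⟨ sym (subsetAt-subsetIndex S i) ⟩
  subsetAt (subsetIndex S) i    ≡⟨ cong (λ a → subsetAt a i) eq ⟩
  subsetAt (subsetIndex T) i    ≡⟨ subsetAt-subsetIndex T i ⟩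
  T i                           ∎
  where open ≡-Reasoning

toℕ-subsetIndex-0 : toℕ (subsetIndex {m} (λ _ → 0F)) ≡ 0
toℕ-subsetIndex-0 {ℕ.zero} = refl
toℕ-subsetIndex-0 {suc m} = trans (FP.toℕ-↑ˡ (subsetIndex {m} (λ _ → 0F)) _) (toℕ-subsetIndex-0 {m})

suc-toℕ-subsetIndex-1 : suc (toℕ (subsetIndex {m} (λ _ → 1F))) ≡ 2 ^ m
suc-toℕ-subsetIndex-1 {ℕ.zero} = refl
suc-toℕ-subsetIndex-1 {suc m} = begin
  suc (toℕ (2 ^ m F.↑ʳ (ones F.↑ˡ 0 ℕ.* 2 ^ m)))
    ≡⟨ cong suc (trans (FP.toℕ-↑ʳ (2 ^ m) (ones F.↑ˡ 0 ℕ.* 2 ^ m)) (cong (2 ^ m ℕ.+_) (FP.toℕ-↑ˡ ones _))) ⟩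
  suc (2 ^ m ℕ.+ toℕ ones)
    ≡⟨ sym (ℕP.+-suc (2 ^ m) (toℕ ones)) ⟩
  2 ^ m ℕ.+ suc (toℕ ones)
    ≡⟨ cong (2 ^ m ℕ.+_) (trans (suc-toℕ-subsetIndex-1 {m}) (sym (ℕP.+-identityʳ (2 ^ m)))) ⟩
  2 ^ suc m ∎
  where
  open ≡-Reasoning
  ones : Fin (2 ^ m)
  ones = subsetIndex {m} (λ _ → 1F)

subsetAt≡const : ∀ (k : Fin (2 ^ m)) b → (∀ i → subsetAt {m} k i ≡ b) → k ≡ subsetIndex {m} (λ _ → b)
subsetAt≡const {m} k b k≗b = finToFun-injective {m} (λ i → trans (k≗b i) (sym (subsetAt-subsetIndex {m} (λ _ → b) i)))

nonConstant⇒isInner : ∀ {S : Fin m → Fin 2} → NonConstant S → IsInner (subsetIndex S)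
nonConstant⇒isInner {m} {S} ((i , Si≡1) , (j , Sj≡0)) = not-first , not-last
  where
  not-first : toℕ (subsetIndex S) ≢ 0
  not-first toℕ≡0 = FP.0≢1+n (trans (sym (subsetIndex-injective index≡ i)) Si≡1)
    where
    index≡ : subsetIndex S ≡ subsetIndex {m} (λ _ → 0F)
    index≡ = FP.toℕ-injective (trans toℕ≡0 (sym (toℕ-subsetIndex-0 {m})))
  not-last : suc (toℕ (subsetIndex S)) ≢ 2 ^ m
  not-last suc-toℕ≡ = FP.0≢1+n (trans (sym Sj≡0) (subsetIndex-injective index≡ j))
    where
    index≡ : subsetIndex S ≡ subsetIndex {m} (λ _ → 1F)
    index≡ = FP.toℕ-injective (ℕP.suc-injective (trans suc-toℕ≡ (sym (suc-toℕ-subsetIndex-1 {m}))))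

isInner⇒nonConstant : ∀ (k : Fin (2 ^ m)) → IsInner k → NonConstant (subsetAt {m} k)
isInner⇒nonConstant {m} k (not-first , not-last) = nonConstant (subsetAt {m} k)
  (λ all-0 → not-first (trans (cong toℕ (subsetAt≡const {m} k 0F all-0)) (toℕ-subsetIndex-0 {m})))
  (λ all-1 → not-last (trans (cong (suc ∘ toℕ) (subsetAt≡const {m} k (1F) all-1))
                              (suc-toℕ-subsetIndex-1 {m})))

-- The Laplacian as a linear map t ↦ Σₖ tₖ bₖ

module _ {n : ℕ} (G : Multigraph n) where

  Aℚ : Fin (suc n) → Fin (suc n) → ℚ
  Aℚ i j = fromℕ (A G i j)

  row≡ : ∀ k c → row G k c ≡ keepIf (does (k F.≟ c)) (fromℕ (deg G k)) - Aℚ k c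
  row≡ k c = trans (fromℤ-- (if does (k F.≟ c) then ℤ.+ deg G k else ℤ.+ 0) (ℤ.+ A G k c))
    (cong (_- Aℚ k c) (fromℤ-if (does (k F.≟ c))))
    where
    fromℤ-if : ∀ b → fromℤ (if b then ℤ.+ deg G k else ℤ.+ 0) ≡ keepIf b (fromℕ (deg G k))
    fromℤ-if true = refl
    fromℤ-if false = refl

  deg≡column-sum : ∀ c → fromℕ (deg G c) ≡ sumℚ (λ k → Aℚ k c)
  deg≡column-sum c = trans (fromℕ-sumℕ (A G c)) (sumℚ-cong (λ k → cong fromℕ (symmetric G c k)))

  sumℚ-row : ∀ c → sumℚ (λ k → row G k c) ≡ 0ℚ
  sumℚ-row c = begin
    sumℚ (λ k → row G k c)
      ≡⟨ sumℚ-cong (λ k → row≡ k c) ⟩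
    sumℚ (λ k → keepIf (does (k F.≟ c)) (fromℕ (deg G k)) - Aℚ k c)
      ≡⟨ sumℚ-- (λ k → keepIf (does (k F.≟ c)) (fromℕ (deg G k))) (λ k → Aℚ k c) ⟩
    sumℚ (λ k → keepIf (does (k F.≟ c)) (fromℕ (deg G k))) - sumℚ (λ k → Aℚ k c)
      ≡⟨ cong (_- sumℚ (λ k → Aℚ k c)) (trans (sumℚ-select c (fromℕ ∘ deg G)) (deg≡column-sum c)) ⟩
    sumℚ (λ k → Aℚ k c) - sumℚ (λ k → Aℚ k c)
      ≡⟨ ℚP.+-inverseʳ (sumℚ (λ k → Aℚ k c)) ⟩
    0ℚ ∎
    where open ≡-Reasoning

  L : (Fin (suc n) → ℚ) → Point n
  L t c = sumℚ (λ k → t k * row G k c)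

  L-cong : ∀ {u v : Fin (suc n) → ℚ} → (∀ k → u k ≡ v k) → L u ≈ᵖ L v
  L-cong u≗v c = sumℚ-cong (λ k → cong (_* row G k c) (u≗v k))

  L-const : ∀ a → L (λ _ → a) ≈ᵖ (λ _ → 0ℚ)
  L-const a c = trans (sumℚ-*ˡ a (λ k → row G k c)) (trans (cong (a *_) (sumℚ-row c)) (ℚP.*-zeroʳ a))

  L-shift : ∀ t a → L (λ k → t k + a) ≈ᵖ L t
  L-shift t a c = begin
    L (λ k → t k + a) c                           ≡⟨ sumℚ-cong (λ k → ℚP.*-distribʳ-+ (row G k c) (t k) a) ⟩
    sumℚ (λ k → t k * row G k c + a * row G k c)  ≡⟨ sumℚ-+ (λ k → t k * row G k c) (λ k → a * row G k c) ⟩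
    L t c + L (λ _ → a) c                         ≡⟨ cong (L t c +_) (L-const a c) ⟩
    L t c + 0ℚ                                    ≡⟨ ℚP.+-identityʳ (L t c) ⟩
    L t c                                         ∎
    where open ≡-Reasoning

  L-mix : ∀ s (u v : Fin (suc n) → ℚ) → L (λ k → mix s (u k) (v k)) ≈ᵖ combo s (L u) (L v)
  L-mix s u v c = begin
    L (λ k → mix s (u k) (v k)) c
      ≡⟨ sumℚ-cong (λ k → distrib (u k) (v k) (row G k c)) ⟩
    sumℚ (λ k → s * (u k * row G k c) + (1ℚ - s) * (v k * row G k c))
      ≡⟨ sumℚ-+ (λ k → s * (u k * row G k c)) (λ k → (1ℚ - s) * (v k * row G k c)) ⟩
    sumℚ (λ k → s * (u k * row G k c)) + sumℚ (λ k → (1ℚ - s) * (v k * row G k c))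
      ≡⟨ cong₂ _+_ (sumℚ-*ˡ s (λ k → u k * row G k c)) (sumℚ-*ˡ (1ℚ - s) (λ k → v k * row G k c)) ⟩
    combo s (L u) (L v) c ∎
    where
    open ≡-Reasoning
    distrib : ∀ x y r → mix s x y * r ≡ s * (x * r) + (1ℚ - s) * (y * r)
    distrib = solve 4 (λ s x y r → (s :* x :+ (con 1ℚ :- s) :* y) :* r
                                   := s :* (x :* r) :+ (con 1ℚ :- s) :* (y :* r)) refl s

  L-- : ∀ (u v : Fin (suc n) → ℚ) → L (λ k → u k - v k) ≈ᵖ (λ c → L u c - L v c)
  L-- u v c = trans (sumℚ-cong (λ k → distrib (u k) (v k) (row G k c)))
    (sumℚ-- (λ k → u k * row G k c) (λ k → v k * row G k c))
    where
    distrib : ∀ x y r → (x - y) * r ≡ x * r - y * r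
    distrib = solve 3 (λ x y r → (x :- y) :* r := x :* r :- y :* r) refl

  L-as-differences : ∀ x c → L x c ≡ sumℚ (λ k → Aℚ c k * (x c - x k))
  L-as-differences x c = begin
    L x c
      ≡⟨ sumℚ-cong (λ k → trans (cong (x k *_) (row≡ k c)) (expand k)) ⟩
    sumℚ (λ k → keepIf (does (k F.≟ c)) (x k * fromℕ (deg G k)) - x k * Aℚ c k)
      ≡⟨ sumℚ-- (λ k → keepIf (does (k F.≟ c)) (x k * fromℕ (deg G k))) (λ k → x k * Aℚ c k) ⟩
    sumℚ (λ k → keepIf (does (k F.≟ c)) (x k * fromℕ (deg G k))) - sumℚ (λ k → x k * Aℚ c k)
      ≡⟨ cong (_- sumℚ (λ k → x k * Aℚ c k)) (sumℚ-select c (λ k → x k * fromℕ (deg G k))) ⟩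
    x c * fromℕ (deg G c) - sumℚ (λ k → x k * Aℚ c k)
      ≡⟨ cong (λ d → x c * d - sumℚ (λ k → x k * Aℚ c k)) (fromℕ-sumℕ (A G c)) ⟩
    x c * sumℚ (Aℚ c) - sumℚ (λ k → x k * Aℚ c k)
      ≡⟨ cong (_- sumℚ (λ k → x k * Aℚ c k)) (sym (sumℚ-*ˡ (x c) (Aℚ c))) ⟩
    sumℚ (λ k → x c * Aℚ c k) - sumℚ (λ k → x k * Aℚ c k)
      ≡⟨ sym (sumℚ-- (λ k → x c * Aℚ c k) (λ k → x k * Aℚ c k)) ⟩
    sumℚ (λ k → x c * Aℚ c k - x k * Aℚ c k)
      ≡⟨ sumℚ-cong (λ k → solve 3 (λ a b q → a :* q :- b :* q := q :* (a :- b)) refl (x c) (x k) (Aℚ c k)) ⟩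
    sumℚ (λ k → Aℚ c k * (x c - x k)) ∎
    where
    open ≡-Reasoning
    expand : ∀ k → x k * (keepIf (does (k F.≟ c)) (fromℕ (deg G k)) - Aℚ k c)
                   ≡ keepIf (does (k F.≟ c)) (x k * fromℕ (deg G k)) - x k * Aℚ c k
    expand k rewrite symmetric G k c with does (k F.≟ c)
    ... | true = solve 3 (λ a b d → a :* (b :- d) := a :* b :- a :* d) refl (x k) (fromℕ (deg G k)) (Aℚ c k)
    ... | false = solve 2 (λ a d → a :* (con 0ℚ :- d) := con 0ℚ :- a :* d) refl (x k) (Aℚ c k)

  Zonotope : Point n → Set
  Zonotope x = ∃ λ t → UnitCube t × x ≈ᵖ L t

  Hdel⇒Zonotope : ∀ x → Hdel G x → Zonotope x
  Hdel⇒Zonotope x (σ , l , 0≤l , Σl≡1 , x≈) = t , t∈ , x≈Lt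
    where
    t : Fin (suc n) → ℚ
    t k = suffixSumℚ l (σ ⟨$⟩ˡ k)
    t∈ : UnitCube t
    t∈ k = suffixSumℚ-nonNeg l 0≤l (σ ⟨$⟩ˡ k) ,
           subst (t k ℚ.≤_) Σl≡1 (suffixSumℚ-≤-sum l 0≤l (σ ⟨$⟩ˡ k))
    x≈Lt : x ≈ᵖ L t
    x≈Lt c = begin
      x c
        ≡⟨ x≈ c ⟩
      sumℚ (λ i → l i * prefixSumℚ (λ j → row G (σ ⟨$⟩ʳ j) c) i)
        ≡⟨ summation-by-parts l (λ j → row G (σ ⟨$⟩ʳ j) c) ⟩
      sumℚ (λ j → suffixSumℚ l j * row G (σ ⟨$⟩ʳ j) c)
        ≡⟨ sumℚ-cong (λ j → cong (λ i → suffixSumℚ l i * row G (σ ⟨$⟩ʳ j) c) (sym (inverseˡ σ {j}))) ⟩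
      sumℚ (λ j → t (σ ⟨$⟩ʳ j) * row G (σ ⟨$⟩ʳ j) c)
        ≡⟨ sym (sumℚ-permute σ (λ k → t k * row G k c)) ⟩
      L t c ∎
      where open ≡-Reasoning

  -- Sort t decreasingly along σ. Adding K = 1 − t_{σ 0} to every coefficient leaves L t unchanged
  -- and turns the coefficients into suffix sums of nonnegative weights with total 1.
  Zonotope⇒Hdel : ∀ x → Zonotope x → Hdel G x
  Zonotope⇒Hdel x (t , t∈ , x≈Lt) with sortDescending t
  ... | σ , desc = σ , l , differences-nonNeg b K desc 0≤b+K , Σl≡1 , x≈
    where
    b : Fin (suc n) → ℚ
    b j = t (σ ⟨$⟩ʳ j)
    K : ℚ
    K = 1ℚ - b F.zero
    l : Fin (suc n) → ℚ
    l = differences b K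
    0≤b+K : ∀ j → 0ℚ ℚ.≤ b j + K
    0≤b+K j = +-nonNeg (proj₁ (t∈ _)) (p≤q⇒0≤q-p (proj₂ (t∈ _)))
    Σl≡1 : sumℚ l ≡ 1ℚ
    Σl≡1 = trans (sumℚ-differences b K) (solve 1 (λ a → a :+ (con 1ℚ :- a) := con 1ℚ) refl (b F.zero))
    x≈ : x ≈ᵖ (λ c → sumℚ (λ i → l i * prefixSum G σ i c))
    x≈ c = begin
      x c                                   ≡⟨ x≈Lt c ⟩
      L t c                                 ≡⟨ sym (L-shift t K c) ⟩
      L (λ k → t k + K) c                   ≡⟨ sumℚ-permute σ (λ k → (t k + K) * row G k c) ⟩
      sumℚ (λ j → (b j + K) * β j)          ≡⟨ sumℚ-cong (λ j → cong (_* β j) (sym (suffixSumℚ-differences b K j))) ⟩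
      sumℚ (λ j → suffixSumℚ l j * β j)     ≡⟨ sym (summation-by-parts l β) ⟩
      sumℚ (λ i → l i * prefixSum G σ i c)  ∎
      where
      open ≡-Reasoning
      β : Fin (suc n) → ℚ
      β j = row G (σ ⟨$⟩ʳ j) c

  InConvexHull⇒Zonotope : ∀ {m} (τ : Fin m → Fin (suc n) → ℚ) → (∀ k → UnitCube (τ k)) →
    ∀ {x} → InConvexHull (λ k → L (τ k)) x → Zonotope x
  InConvexHull⇒Zonotope τ τ∈ {x} (μ , 0≤μ , Σμ≡1 , x≈) = t , t∈ , x≈Lt
    where
    t : Fin (suc n) → ℚ
    t j = sumℚ (λ k → μ k * τ k j)
    μτ≤μ : ∀ k j → μ k * τ k j ℚ.≤ μ k
    μτ≤μ k j = ℚP.≤-trans (ℚP.*-monoˡ-≤-nonNeg (μ k) {{ℚ.nonNegative (0≤μ k)}} (proj₂ (τ∈ k j)))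
                          (ℚP.≤-reflexive (ℚP.*-identityʳ (μ k)))
    t∈ : UnitCube t
    t∈ j = sumℚ-nonNeg (λ k → *-nonNeg (0≤μ k) (proj₁ (τ∈ k j))) ,
           subst (t j ℚ.≤_) Σμ≡1 (sumℚ-mono-≤ (λ k → μτ≤μ k j))
    x≈Lt : x ≈ᵖ L t
    x≈Lt c = begin
      x c
        ≡⟨ x≈ c ⟩
      sumℚ (λ k → μ k * sumℚ (λ j → τ k j * row G j c))
        ≡⟨ sumℚ-cong (λ k → sym (sumℚ-*ˡ (μ k) (λ j → τ k j * row G j c))) ⟩
      sumℚ (λ k → sumℚ (λ j → μ k * (τ k j * row G j c)))
        ≡⟨ sumℚ-comm (λ k j → μ k * (τ k j * row G j c)) ⟩
      sumℚ (λ j → sumℚ (λ k → μ k * (τ k j * row G j c)))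
        ≡⟨ sumℚ-cong (λ j → trans (sumℚ-cong (λ k → sym (ℚP.*-assoc (μ k) (τ k j) (row G j c))))
                                  (sumℚ-*ʳ (row G j c) (λ k → μ k * τ k j))) ⟩
      L t c ∎
      where open ≡-Reasoning

  initialSegment : Permutation′ (suc n) → Fin (suc n) → Fin (suc n) → Fin 2
  initialSegment σ i k = if (σ ⟨$⟩ˡ k) ≤ᵇ i then 1F else 0F

  L-initialSegment≈prefixSum : ∀ σ i → L (χ (initialSegment σ i)) ≈ᵖ prefixSum G σ i
  L-initialSegment≈prefixSum σ i c = begin
    L (χ S) c
      ≡⟨ sumℚ-permute σ (λ k → χ S k * row G k c) ⟩
    sumℚ (λ j → χ S (σ ⟨$⟩ʳ j) * row G (σ ⟨$⟩ʳ j) c)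
      ≡⟨ sumℚ-cong (λ j → trans (cong (λ k → bitℚ (if k ≤ᵇ i then 1F else 0F) * row G (σ ⟨$⟩ʳ j) c)
                                      (inverseˡ σ {j}))
                                (bit-* (j ≤ᵇ i) (row G (σ ⟨$⟩ʳ j) c))) ⟩
    prefixSum G σ i c ∎
    where
    open ≡-Reasoning
    S : Fin (suc n) → Fin 2
    S = initialSegment σ i
    bit-* : ∀ b r → bitℚ (if b then 1F else 0F) * r ≡ keepIf b r
    bit-* true r = ℚP.*-identityˡ r
    bit-* false r = ℚP.*-zeroˡ r

  corner : Fin (2 ^ suc n) → Point n
  corner k = L (χ (subsetAt k))

  Hdel⇒InConvexHull-corner : ∀ x → Hdel G x → InConvexHull corner x
  Hdel⇒InConvexHull-corner x (σ , x∈△σ) =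
    InConvexHull-reindex (subsetIndex ∘ initialSegment σ) prefixSum≈corner x∈△σ
    where
    prefixSum≈corner : ∀ i → prefixSum G σ i ≈ᵖ corner (subsetIndex (initialSegment σ i))
    prefixSum≈corner i c = trans (sym (L-initialSegment≈prefixSum σ i c))
      (L-cong (λ k → cong bitℚ (sym (subsetAt-subsetIndex (initialSegment σ i) k))) c)

  Hdel-isConvexPolytope : IsConvexPolytope (Hdel G)
  Hdel-isConvexPolytope = 2 ^ suc n , corner , λ x →
    Hdel⇒InConvexHull-corner x ,
    Zonotope⇒Hdel x ∘ InConvexHull⇒Zonotope (χ ∘ subsetAt) (χ-UnitCube ∘ subsetAt)

  module _ (connected : Connected G) where

    -- Maximum principle: at a maximum c, L x c is a sum of nonnegative terms A_ck (x_c − x_k).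
    L≡0⇒constant : (x : Fin (suc n) → ℚ) → (∀ c → L x c ≡ 0ℚ) → ∀ i j → x i ≡ x j
    L≡0⇒constant x Lx≡0 i j with argmax x
    ... | M , x≤xM = trans (spread (connected M i) x≤xM) (sym (spread (connected M j) x≤xM))
      where
      IsMax : Fin (suc n) → Set
      IsMax c = ∀ l → x l ℚ.≤ x c

      neighbour : ∀ {c k} → IsMax c → 0 ℕ.< A G c k → x k ≡ x c
      neighbour {c} {k} max 0<A =
        sym (p-q≡0⇒p≡q {x c} {x k} (p*q≡0⇒q≡0 {Aℚ c k} {x c - x k} (fromℕ-pos (A G c k) 0<A) term-k≡0))
        where
        term : Fin (suc n) → ℚ
        term l = Aℚ c l * (x c - x l)
        term-nonNeg : ∀ l → 0ℚ ℚ.≤ term l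
        term-nonNeg l = *-nonNeg (fromℕ-nonNeg (A G c l)) (p≤q⇒0≤q-p (max l))
        term-k≡0 : term k ≡ 0ℚ
        term-k≡0 = sumℚ≡0⇒≡0 {f = term} term-nonNeg (trans (sym (L-as-differences x c)) (Lx≡0 c)) k

      spread : ∀ {c k} → Reachable G c k → IsMax c → x k ≡ x c
      spread here _ = refl
      spread {c} (step {j = j} 0<A reach) max = trans (spread reach max-at-j) xj≡xc
        where
        xj≡xc : x j ≡ x c
        xj≡xc = neighbour max 0<A
        max-at-j : IsMax j
        max-at-j l = subst (x l ℚ.≤_) (sym xj≡xc) (max l)

    L-injective-up-to-constants : ∀ u v → L u ≈ᵖ L v → ∀ i j → u i - v i ≡ u j - v j
    L-injective-up-to-constants u v Lu≈Lv =
      L≡0⇒constant (λ k → u k - v k) (λ c → trans (L-- u v c) (trans (cong (_- L v c) (Lu≈Lv c)) (ℚP.+-inverseʳ (L v c))))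

    -- χ S − r is constant; it is ≥ 0 where S is 1 and ≤ 0 where S is 0, hence it vanishes.
    χ-rigid : ∀ {S} {r : Fin (suc n) → ℚ} → NonConstant S → UnitCube r → L (χ S) ≈ᵖ L r → ∀ k → r k ≡ χ S k
    χ-rigid {S} {r} ((i , Si≡1) , (j , Sj≡0)) r∈ LχS≈Lr k =
      sym (p-q≡0⇒p≡q {χ S k} {r k} (trans (constant k i) di≡0))
      where
      constant : ∀ a b → χ S a - r a ≡ χ S b - r b
      constant = L-injective-up-to-constants (χ S) r LχS≈Lr
      0≤di : 0ℚ ℚ.≤ χ S i - r i
      0≤di = subst (λ a → 0ℚ ℚ.≤ a - r i) (sym (cong bitℚ Si≡1)) (p≤q⇒0≤q-p (proj₂ (r∈ i)))
      dj≤0 : χ S j - r j ℚ.≤ 0ℚ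
      dj≤0 = subst (λ a → a - r j ℚ.≤ 0ℚ) (sym (cong bitℚ Sj≡0))
        (subst (ℚ._≤ 0ℚ) (sym (ℚP.+-identityˡ (- r j))) (ℚP.neg-antimono-≤ (proj₁ (r∈ j))))
      di≡0 : χ S i - r i ≡ 0ℚ
      di≡0 = ℚP.≤-antisym (ℚP.≤-trans (ℚP.≤-reflexive (constant i j)) dj≤0) 0≤di

    χ-injective : ∀ {S T} → NonConstant S → L (χ S) ≈ᵖ L (χ T) → ∀ k → S k ≡ T k
    χ-injective {S} {T} S-nc LχS≈LχT k = bitℚ-injective (sym (χ-rigid S-nc (χ-UnitCube T) LχS≈LχT k))

    χ-isVertex : ∀ {S} → NonConstant S → IsVertex Zonotope (L (χ S))
    χ-isVertex {S} S-nc = (χ S , χ-UnitCube S , λ _ → refl) , not-split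
      where
      not-split : ∀ y z s → Zonotope y → Zonotope z → 0ℚ ℚ.< s → s ℚ.< 1ℚ →
                  ¬ (y ≈ᵖ z) → ¬ (L (χ S) ≈ᵖ combo s y z)
      not-split y z s (t₁ , t₁∈ , y≈) (t₂ , t₂∈ , z≈) 0<s s<1 y≉z LχS≈ =
        y≉z (λ c → trans (y≈ c) (trans (L-cong t₁≗t₂ c) (sym (z≈ c))))
        where
        r : Fin (suc n) → ℚ
        r k = mix s (t₁ k) (t₂ k)
        LχS≈Lr : L (χ S) ≈ᵖ L r
        LχS≈Lr c = trans (LχS≈ c)
          (trans (cong₂ (mix s) (y≈ c) (z≈ c)) (sym (L-mix s t₁ t₂ c)))
        r≡χS : ∀ k → r k ≡ χ S k
        r≡χS = χ-rigid S-nc (mix-UnitCube (0<s , s<1) t₁∈ t₂∈) LχS≈Lr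
        t₁≗t₂ : ∀ k → t₁ k ≡ t₂ k
        t₁≗t₂ k = mix≡bitℚ⇒≡ (0<s , s<1) (t₁∈ k) (t₂∈ k) (S k) (r≡χS k)

    module _ (1≤n : 1 ≤ n) where

      -- Moving one interior coordinate of t up and down splits x into two distinct points of the zonotope.
      interior⇒¬isVertex : ∀ {x t} → x ≈ᵖ L t → UnitCube t → ∀ i → OpenUnitInterval (t i) → ¬ IsVertex Zonotope x
      interior⇒¬isVertex {x} {t} x≈Lt t∈ i ti∈ = split (split-OpenUnitInterval ti∈) (another 1≤n i)
        where
        set : ℚ → Fin (suc n) → ℚ
        set a = updateAt t i (λ _ → a)

        set-UnitCube : ∀ {a} → UnitInterval a → UnitCube (set a)
        set-UnitCube {a} a∈ k with k F.≟ i
        ... | yes refl = subst UnitInterval (sym (updateAt-updates i t)) a∈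
        ... | no k≢i = subst UnitInterval (sym (updateAt-minimal k i t k≢i)) (t∈ k)

        mix-set : ∀ {a b} → mix ½ a b ≡ t i → ∀ k → mix ½ (set a k) (set b k) ≡ t k
        mix-set {a} {b} mix≡ti k with k F.≟ i
        ... | yes refl = trans (cong₂ (mix ½) (updateAt-updates i t) (updateAt-updates i t)) mix≡ti
        ... | no k≢i = trans (cong₂ (mix ½) (updateAt-minimal k i t k≢i) (updateAt-minimal k i t k≢i))
                             (mix-idem ½ (t k))

        split : (∃ λ a → ∃ λ b → UnitInterval a × UnitInterval b × a ≢ b × mix ½ a b ≡ t i) →
                (∃ λ j → j ≢ i) → ¬ IsVertex Zonotope x
        split (a , b , a∈ , b∈ , a≢b , mix≡ti) (j , j≢i) (_ , extreme) =
          extreme (L (set a)) (L (set b)) ½ (set a , set-UnitCube a∈ , λ _ → refl)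
            (set b , set-UnitCube b∈ , λ _ → refl) 0<½ ½<1 distinct x≈mix
          where
          x≈mix : x ≈ᵖ combo ½ (L (set a)) (L (set b))
          x≈mix c = trans (x≈Lt c) (trans (sym (L-cong (mix-set mix≡ti) c)) (L-mix ½ (set a) (set b) c))
          distinct : ¬ (L (set a) ≈ᵖ L (set b))
          distinct La≈Lb = a≢b (p-q≡0⇒p≡q {a} {b} (begin
            a - b                 ≡⟨ sym (cong₂ _-_ (updateAt-updates i t) (updateAt-updates i t)) ⟩
            set a i - set b i     ≡⟨ L-injective-up-to-constants (set a) (set b) La≈Lb i j ⟩
            set a j - set b j     ≡⟨ cong₂ _-_ (updateAt-minimal j i t j≢i) (updateAt-minimal j i t j≢i) ⟩
            t j - t j             ≡⟨ ℚP.+-inverseʳ (t j) ⟩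
            0ℚ                    ∎))
            where open ≡-Reasoning

      origin-¬isVertex : ∀ {x} → x ≈ᵖ (λ _ → 0ℚ) → ¬ IsVertex Zonotope x
      origin-¬isVertex x≈0 = interior⇒¬isVertex (λ c → trans (x≈0 c) (sym (L-const ½ c)))
        (λ _ → ℚP.<⇒≤ 0<½ , ℚP.<⇒≤ ½<1) F.zero (0<½ , ½<1)

      isVertex⇒χ : ∀ {x} → IsVertex Zonotope x → ∃ λ S → NonConstant S × x ≈ᵖ L (χ S)
      isVertex⇒χ {x} x-vertex@((t , t∈ , x≈Lt) , _)
        with FP.any? (λ i → (0ℚ ℚP.<? t i) ×-dec (t i ℚP.<? 1ℚ))
      ... | yes (i , ti∈) = ⊥-elim (interior⇒¬isVertex x≈Lt t∈ i ti∈ x-vertex)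
      ... | no no-interior = S , nonConstant S (¬constant 0F) (¬constant (1F)) , x≈LχS
        where
        S : Fin (suc n) → Fin 2
        S k = if does (t k ℚP.≟ 1ℚ) then 1F else 0F
        χS≡t : ∀ k → χ S k ≡ t k
        χS≡t k with t k ℚP.≟ 1ℚ
        ... | yes tk≡1 = sym tk≡1
        ... | no tk≢1 = sym (UnitInterval-boundary (t∈ k) (λ tk∈ → no-interior (k , tk∈)) tk≢1)
        x≈LχS : x ≈ᵖ L (χ S)
        x≈LχS c = trans (x≈Lt c) (L-cong (λ k → sym (χS≡t k)) c)
        ¬constant : ∀ b → ¬ (∀ k → S k ≡ b)
        ¬constant b S≡b = origin-¬isVertex
          (λ c → trans (x≈LχS c) (trans (L-cong (λ k → cong bitℚ (S≡b k)) c) (L-const (bitℚ b) c))) x-vertex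

      2≤2^[1+n] : 2 ≤ 2 ^ suc n
      2≤2^[1+n] = ℕP.*-monoʳ-≤ 2 (ℕP.m^n>0 2 n)

      vertexIndex : Fin (2 ^ suc n ∸ 2) → Fin (2 ^ suc n)
      vertexIndex = innerIndex 2≤2^[1+n]

      vertex : Fin (2 ^ suc n ∸ 2) → Point n
      vertex k = corner (vertexIndex k)

      vertex-nonConstant : ∀ k → NonConstant (subsetAt {suc n} (vertexIndex k))
      vertex-nonConstant k = isInner⇒nonConstant {suc n} (vertexIndex k) (innerIndex-isInner 2≤2^[1+n] k)

      vertex-injective : ∀ k l → vertex k ≈ᵖ vertex l → k ≡ l
      vertex-injective k l vk≈vl = innerIndex-injective 2≤2^[1+n]
        (finToFun-injective {suc n} (χ-injective (vertex-nonConstant k) vk≈vl))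

      χ≈vertex : ∀ S → NonConstant S → ∃ λ k → L (χ S) ≈ᵖ vertex k
      χ≈vertex S S-nc = map₂ (λ k↦S → L-cong (λ i → cong bitℚ (sym (subsetAt-vertex k↦S i))))
        (innerIndex-surjective 2≤2^[1+n] (subsetIndex S) (nonConstant⇒isInner S-nc))
        where
        subsetAt-vertex : ∀ {k} → vertexIndex k ≡ subsetIndex S → ∀ i → subsetAt (vertexIndex k) i ≡ S i
        subsetAt-vertex k↦S i = trans (cong (λ a → subsetAt a i) k↦S) (subsetAt-subsetIndex S i)

      isVertex⇒vertex : ∀ x → IsVertex (Hdel G) x → ∃ λ k → x ≈ᵖ vertex k
      isVertex⇒vertex x x-vertex = via-χ (isVertex⇒χ (IsVertex-cong Hdel⇒Zonotope Zonotope⇒Hdel x-vertex))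
        where
        via-χ : (∃ λ S → NonConstant S × x ≈ᵖ L (χ S)) → ∃ λ k → x ≈ᵖ vertex k
        via-χ (S , S-nc , x≈LχS) = map₂ (λ LχS≈vk c → trans (x≈LχS c) (LχS≈vk c)) (χ≈vertex S S-nc)

      Hdel-vertices : HasExactlyVertices (Hdel G) (2 ^ suc n ∸ 2)
      Hdel-vertices = vertex ,
        (λ k → IsVertex-cong Zonotope⇒Hdel Hdel⇒Zonotope (χ-isVertex (vertex-nonConstant k))) ,
        vertex-injective , isVertex⇒vertex

mainTheorem13 : (n : ℕ) → 1 ≤ n → (G : Multigraph n) → Connected G →
    IsConvexPolytope (Hdel G) × HasExactlyVertices (Hdel G) (2 ^ (suc n) ∸ 2)
mainTheorem13 n 1≤n G connected = Hdel-isConvexPolytope G , Hdel-vertices G connected 1≤n
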